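{- Let $q$ be a prime, $F := \mathbf{Z}/q\mathbf{Z}$, let $B$ be a non-empty subset of $F$, and let $k > 1$ be an integer such that there exist $\xi_1, \ldots, \xi_k \in F$ for which the map $B^k \to F$, $(a_1,\dots,a_k) \mapsto \sum_{j=1}^k a_j \xi_j$, is surjective. Let $\tilde B := B\cdot(B-B) + B\cdot(B-B)$. Then there exist $\eta_1, \ldots, \eta_{k-1} \in F$ such that the map $\tilde B^{k-1} \to F$, $(a_1,\dots,a_{k-1}) \mapsto \sum_{j=1}^{k-1} a_j \eta_j$, is surjective.
   Context: $B - B := \{b - b' : b, b' \in B\}$, $B\cdot(B-B) := \{b(b'-b'') : b,b',b'' \in B\}$, and $X + Y := \{x+y : x\in X, y \in Y\}$. A "linear surjection from $B^k$ to $F$" means a map of the form $(a_1,\dots,a_k)\mapsto\sum_j a_j\xi_j$ with fixed $\xi_j\in F$ that is surjective. -}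

module Defs where

open import Data.Nat using (ℕ; zero; suc; _+_; _*_; _∸_; NonZero)
open import Data.Nat.DivMod using (_mod_)
open import Data.Fin using (Fin; toℕ) renaming (zero to fzero; suc to fsuc)
open import Data.Product using (Σ; ∃; _×_; _,_)
open import Relation.Binary.PropositionalEquality using (_≡_)

ZMod : ℕ → Set
ZMod q = Fin q

module _ {q : ℕ} .{{_ : NonZero q}} where

  _+F_ : ZMod q → ZMod q → ZMod q
  a +F b = (toℕ a + toℕ b) mod q

  _*F_ : ZMod q → ZMod q → ZMod q
  a *F b = (toℕ a * toℕ b) mod q

  -F_ : ZMod q → ZMod q
  -F a = (q ∸ toℕ a) mod q

  _-F_ : ZMod q → ZMod q → ZMod q
  a -F b = a +F (-F b)

  zeroF : ZMod q
  zeroF = 0 mod q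

  sumF : (n : ℕ) → (Fin n → ZMod q) → ZMod q
  sumF zero f = zeroF
  sumF (suc n) f = f fzero +F sumF n (λ j → f (fsuc j))

  Subset : Set₁
  Subset = ZMod q → Set

  BmulBminusB : Subset → Subset
  BmulBminusB B x = Σ (ZMod q) λ b → Σ (ZMod q) λ b' → Σ (ZMod q) λ b'' →
    B b × B b' × B b'' × (x ≡ b *F (b' -F b''))

  sumset : Subset → Subset → Subset
  sumset X Y z = Σ (ZMod q) λ x → Σ (ZMod q) λ y → X x × Y y × (z ≡ x +F y)

  LinSurj : Subset → (k : ℕ) → (Fin k → ZMod q) → Set
  LinSurj B k ξ = (y : ZMod q) →
    Σ (Fin k → ZMod q) λ a → ((j : Fin k) → B (a j)) × (sumF k (λ j → a j *F ξ j) ≡ y)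

-- A right inverse y ↦ a(y) of L : B^k → F, u ↦ Σ u_j ξ_j, only uses the finitely many
-- elements V of B occurring in the vectors a(y), so q ≤ |V|^k; as q is prime and k ≥ 2 the
-- inequality is strict, and pigeonhole yields t ≠ t' in V^k with L t = L t', say t_m ≠ t'_m.
-- Eliminating coordinate m between a(y) and t' − t, using L t = L t', gives
--   (t_m − t'_m) y = Σ_{j ≠ m} (a_j (t_m − t'_m) + a_m (t'_j − t_j)) ξ_j,
-- whose coefficients lie in B·(B−B) + B·(B−B); so η_j = ξ_j / (t_m − t'_m) for j ≠ m.
-- Arithmetic in Z/qZ is verified in ℤ, modulo q.
module Submission where

open import Defs
open import Algebra.Properties.CommutativeMonoid.Sum as Sum using ()
open import Algebra.Properties.Semiring.Sum as SemiringSum using ()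
open import Data.Fin using (Fin; zero; suc; toℕ; fromℕ<; punchIn; combine; funToFin; finToFun; _≟_)
open import Data.Fin.Properties
  using (any?; toℕ<n; toℕ-injective; toℕ-fromℕ<; pigeonhole; injective⇒≤; <⇒≢; ¬∀⟶∃¬;
         funToFin-finToFin; finToFun-funToFin)
open import Data.Integer as ℤ using (ℤ; +_; _+_; _*_; -_; _-_; ∣_∣; _⊖_; 0ℤ; 1ℤ; _%ℕ_; _/ℕ_)
import Data.Integer.Properties as ℤ
open import Data.Integer.DivMod using (n%ℕd<d; a≡a%ℕn+[a/ℕn]*n)
open import Data.Integer.Divisibility.Signed using (_∣_; divides; ∣⇒∣ᵤ; ∣m⇒∣-m; ∣m∣n⇒∣m+n; ∣m⇒∣m*n; ∣n⇒∣m*n)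
open import Data.Integer.Tactic.RingSolver using (solve-∀)
open import Data.List using (List; length; lookup; filter; allFin)
open import Data.List.Membership.Propositional using (_∈_)
open import Data.List.Membership.Propositional.Properties using (∈-lookup; ∈-allFin; ∈-filter⁺; ∈-filter⁻)
open import Data.List.Relation.Unary.All as All using ()
open import Data.List.Relation.Unary.Any using (index)
open import Data.List.Relation.Unary.Any.Properties using (lookup-index)
open import Data.List.Relation.Unary.Unique.Propositional using (Unique; _∷_)
open import Data.List.Relation.Unary.Unique.Propositional.Properties using (allFin⁺; filter⁺)
open import Data.Nat as ℕ using (ℕ; zero; suc; NonZero; _∸_; _^_; _>_; _<_; s≤s)
import Data.Nat.Properties as ℕ
open import Data.Nat.Coprimality using (coprime-Bézout; prime⇒coprime)
open import Data.Nat.DivMod using (_mod_; m<n⇒m%n≡m)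
open import Data.Nat.Divisibility using (m∣m*n; n∣m⇒m%n≡0)
open import Data.Nat.GCD using (module Bézout)
open import Data.Nat.Primality using (Prime; prime⇒irreducible; prime⇒nonZero; ¬prime[1])
open import Data.Product using (Σ; ∃; ∃₂; _×_; _,_; proj₁; proj₂)
open import Data.Sum using (inj₁; inj₂)
open import Data.Vec.Functional using (Vector; removeAt)
open import Function using (_∘_)
open import Relation.Binary.Bundles using (Setoid)
open import Relation.Binary.Structures using (IsEquivalence)
open import Relation.Binary.PropositionalEquality
  using (_≡_; _≢_; _≗_; refl; sym; trans; cong; cong₂; subst; module ≡-Reasoning)
open import Relation.Nullary using (¬_; Dec; contradiction)

open Sum ℤ.+-0-commutativeMonoid using (sum; sum-remove; sum-cong-≗; ∑-distrib-+)
open SemiringSum ℤ.+-*-semiring using (*-distribˡ-sum; *-distribʳ-sum)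

lookup-injective : ∀ {A : Set} {xs : List A} → Unique xs →
  ∀ {i j} → lookup xs i ≡ lookup xs j → i ≡ j
lookup-injective (_ ∷ _) {zero} {zero} _ = refl
lookup-injective (x≢ ∷ _) {zero} {suc j} eq = contradiction eq (All.lookup x≢ (∈-lookup j))
lookup-injective (x≢ ∷ _) {suc i} {zero} eq = contradiction (sym eq) (All.lookup x≢ (∈-lookup i))
lookup-injective (_ ∷ uniq) {suc i} {suc j} eq = cong suc (lookup-injective uniq eq)

¬prime-power : ∀ n k → ¬ Prime (n ^ suc (suc k))
¬prime-power n k pr = ¬prime[1] (subst Prime (trans (cong (_^ suc (suc k)) n≡1) (ℕ.^-zeroˡ (suc (suc k)))) pr)
  where
  n≡1 : n ≡ 1
  n≡1 with prime⇒irreducible pr (m∣m*n (n ^ suc k))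
  ... | inj₁ n≡1 = n≡1
  ... | inj₂ n≡p = ℕ.m*n≡1⇒m≡1 n (n ^ k)
    (ℕ.*-cancelˡ-≡ (n ^ suc k) 1 n {{subst NonZero (sym n≡p) (prime⇒nonZero pr)}}
      (trans (sym n≡p) (sym (ℕ.*-identityʳ n))))

funToFin-cong : ∀ {m n} {f g : Fin m → Fin n} → f ≗ g → funToFin f ≡ funToFin g
funToFin-cong {zero} _ = refl
funToFin-cong {suc m} f≗g = cong₂ combine (f≗g zero) (funToFin-cong (f≗g ∘ suc))

module _ {n q k} (q-prime : Prime q)
  (L : (Fin (suc (suc k)) → Fin n) → Fin q) (L-cong : ∀ {u v} → u ≗ v → L u ≡ L v)
  (s : Fin q → Fin (suc (suc k)) → Fin n) (L∘s : ∀ y → L (s y) ≡ y)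
  where

  private
    s-injective : ∀ {y y'} → funToFin (s y) ≡ funToFin (s y') → y ≡ y'
    s-injective {y} {y'} eq = trans (sym (L∘s y)) (trans (L-cong s≗s') (L∘s y'))
      where
      s≗s' : s y ≗ s y'
      s≗s' j = trans (sym (finToFun-funToFin (s y) j))
                 (trans (cong (λ i → finToFun i j) eq) (finToFun-funToFin (s y') j))

    q<n^k : q < n ^ suc (suc k)
    q<n^k = ℕ.≤∧≢⇒< (injective⇒≤ s-injective) (λ eq → ¬prime-power n k (subst Prime eq q-prime))

    distinct : ∀ {i j : Fin (n ^ suc (suc k))} → i ≢ j → ¬ (finToFun {n} {suc (suc k)} i ≗ finToFun j)
    distinct {i} {j} i≢j eq = i≢j (trans (sym (funToFin-finToFin {suc (suc k)} {n} i))
      (trans (funToFin-cong {suc (suc k)} {n} eq) (funToFin-finToFin {suc (suc k)} {n} j)))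

  split-surjection-collides : ∃₂ λ u u' → (∃ λ m → u m ≢ u' m) × L u ≡ L u'
  split-surjection-collides with pigeonhole q<n^k (L ∘ finToFun)
  ... | i , j , i<j , Li≡Lj =
    finToFun i , finToFun j , ¬∀⟶∃¬ _ _ (λ m → finToFun i m ≟ finToFun j m) (distinct (<⇒≢ i<j)) , Li≡Lj

module _ {n q k} (q-prime : Prime q) (B : Fin n → Set) (L : (Fin (suc (suc k)) → Fin n) → Fin q)
  (L-cong : ∀ {u v} → u ≗ v → L u ≡ L v)
  (s : Fin q → Fin (suc (suc k)) → Fin n) (s∈B : ∀ y j → B (s y j)) (L∘s : ∀ y → L (s y) ≡ y)
  where

  private
    -- B need not be decidable, so we count the values of s rather than B itself.
    IsValue : Fin n → Set
    IsValue x = ∃₂ λ y j → s y j ≡ x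

    isValue? : ∀ x → Dec (IsValue x)
    isValue? x = any? λ y → any? λ j → s y j ≟ x

    V : List (Fin n)
    V = filter isValue? (allFin n)

    s∈V : ∀ y j → s y j ∈ V
    s∈V y j = ∈-filter⁺ isValue? (∈-allFin (s y j)) (y , j , refl)

    s′ : Fin q → Fin (suc (suc k)) → Fin (length V)
    s′ y j = index (s∈V y j)

    L∘s′ : ∀ y → L (lookup V ∘ s′ y) ≡ y
    L∘s′ y = trans (L-cong (λ j → sym (lookup-index (s∈V y j)))) (L∘s y)

    lookup∈B : ∀ i → B (lookup V i)
    lookup∈B i with ∈-filter⁻ isValue? {xs = allFin n} (∈-lookup {xs = V} i)
    ... | _ , y , j , syj≡ = subst B syj≡ (s∈B y j)

    V-unique : Unique V
    V-unique = filter⁺ isValue? (allFin⁺ n)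

  split-surjection-collides-within :
    ∃₂ λ t t' → (∀ j → B (t j)) × (∀ j → B (t' j)) × (∃ λ m → t m ≢ t' m) × L t ≡ L t'
  split-surjection-collides-within =
    let u , u' , (m , um≢u'm) , Lu≡Lu' = split-surjection-collides q-prime (L ∘ (lookup V ∘_))
                                            (λ u≗v → L-cong (cong (lookup V) ∘ u≗v)) s′ L∘s′
    in lookup V ∘ u , lookup V ∘ u' , lookup∈B ∘ u , lookup∈B ∘ u' ,
       (m , um≢u'm ∘ lookup-injective V-unique) , Lu≡Lu'

∑-distrib-minus : ∀ {n} (f g : Vector ℤ n) → sum (λ j → f j - g j) ≡ sum f - sum g
∑-distrib-minus {zero} f g = refl
∑-distrib-minus {suc n} f g =
  trans (cong (λ r → f zero - g zero + r) (∑-distrib-minus (f ∘ suc) (g ∘ suc)))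
        (interchange (f zero) (g zero) (sum (f ∘ suc)) (sum (g ∘ suc)))
  where
  interchange : ∀ a b c d → a - b + (c - d) ≡ a + c - (b + d)
  interchange = solve-∀

∑-eliminate : ∀ {k} (m : Fin (suc k)) (a t t' x : Vector ℤ (suc k)) →
  sum (removeAt (λ j → (a j * (t m - t' m) + a m * (t' j - t j)) * x j) m)
    ≡ (t m - t' m) * sum (λ j → a j * x j) + a m * (sum (λ j → t' j * x j) - sum (λ j → t j * x j))
∑-eliminate m a t t' x = begin
  sum (removeAt G m)                          ≡⟨ ℤ.+-identityˡ (sum (removeAt G m)) ⟨
  0ℤ + sum (removeAt G m)                     ≡⟨ cong (_+ sum (removeAt G m)) Gm≡0 ⟨
  G m + sum (removeAt G m)                    ≡⟨ sum-remove G ⟨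
  sum G                                       ≡⟨ sum-cong-≗ (λ j → regroup (a j) (a m) d (t j) (t' j) (x j)) ⟩
  sum (λ j → d * ax j + a m * (t'x j - tx j)) ≡⟨ ∑-distrib-+ (λ j → d * ax j) (λ j → a m * (t'x j - tx j)) ⟩
  sum (λ j → d * ax j) + sum (λ j → a m * (t'x j - tx j))
    ≡⟨ cong₂ _+_ (*-distribˡ-sum d ax) (*-distribˡ-sum (a m) (λ j → t'x j - tx j)) ⟨
  d * sum ax + a m * sum (λ j → t'x j - tx j) ≡⟨ cong (λ r → d * sum ax + a m * r) (∑-distrib-minus t'x tx) ⟩
  d * sum ax + a m * (sum t'x - sum tx)       ∎
  where
  open ≡-Reasoning
  d = t m - t' m
  G ax tx t'x : Vector ℤ _
  G j = (a j * d + a m * (t' j - t j)) * x j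
  ax j = a j * x j
  tx j = t j * x j
  t'x j = t' j * x j

  vanish : ∀ a u u' y → (a * (u - u') + a * (u' - u)) * y ≡ 0ℤ
  vanish = solve-∀

  Gm≡0 : G m ≡ 0ℤ
  Gm≡0 = vanish (a m) (t m) (t' m) (x m)

  regroup : ∀ aj am d tj t'j xj →
    (aj * d + am * (t'j - tj)) * xj ≡ d * (aj * xj) + am * (t'j * xj - tj * xj)
  regroup = solve-∀

pos-affine : ∀ m n o r s → m ℕ.+ n ℕ.* o ≡ r ℕ.* s → + m + + n * + o ≡ + r * + s
pos-affine m n o r s eq = begin
  + m + + n * + o     ≡⟨ cong (λ i → + m + i) (ℤ.pos-* n o) ⟨
  + m + + (n ℕ.* o)   ≡⟨ ℤ.pos-+ m (n ℕ.* o) ⟨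
  + (m ℕ.+ n ℕ.* o)   ≡⟨ cong +_ eq ⟩
  + (r ℕ.* s)         ≡⟨ ℤ.pos-* r s ⟩
  + r * + s           ∎
  where open ≡-Reasoning

module Modular (q : ℕ) .{{_ : NonZero q}} where

  toℤ : Fin q → ℤ
  toℤ x = + toℕ x

  -- A record, so that i and j can be inferred from a proof of i ≋ j.
  infix 4 _≋_
  record _≋_ (i j : ℤ) : Set where
    constructor congruent
    field q∣i-j : + q ∣ i - j

  ≋-of-multiple : ∀ {i j} c → i ≡ j + c * + q → i ≋ j
  ≋-of-multiple {j = j} c refl = congruent (divides c (cancel j (c * + q)))
    where
    cancel : ∀ j x → j + x - j ≡ x
    cancel = solve-∀

  ≋-refl : ∀ {i} → i ≋ i
  ≋-refl {i} = ≋-of-multiple 0ℤ (sym (ℤ.+-identityʳ i))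

  ≋-reflexive : ∀ {i j} → i ≡ j → i ≋ j
  ≋-reflexive refl = ≋-refl

  ≋-sym : ∀ {i j} → i ≋ j → j ≋ i
  ≋-sym {i} {j} (congruent q∣i-j) = congruent (subst (+ q ∣_) (neg-difference i j) (∣m⇒∣-m q∣i-j))
    where
    neg-difference : ∀ i j → - (i - j) ≡ j - i
    neg-difference = solve-∀

  ≋-trans : ∀ {i j k} → i ≋ j → j ≋ k → i ≋ k
  ≋-trans {i} {j} {k} (congruent q∣i-j) (congruent q∣j-k) =
    congruent (subst (+ q ∣_) (telescope i j k) (∣m∣n⇒∣m+n q∣i-j q∣j-k))
    where
    telescope : ∀ i j k → (i - j) + (j - k) ≡ i - k
    telescope = solve-∀

  ≋-isEquivalence : IsEquivalence _≋_
  ≋-isEquivalence = record { refl = ≋-refl ; sym = ≋-sym ; trans = ≋-trans }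

  ≋-setoid : Setoid _ _
  ≋-setoid = record { isEquivalence = ≋-isEquivalence }

  +-cong : ∀ {i j k l} → i ≋ j → k ≋ l → i + k ≋ j + l
  +-cong {i} {j} {k} {l} (congruent q∣i-j) (congruent q∣k-l) =
    congruent (subst (+ q ∣_) (interchange i j k l) (∣m∣n⇒∣m+n q∣i-j q∣k-l))
    where
    interchange : ∀ i j k l → (i - j) + (k - l) ≡ (i + k) - (j + l)
    interchange = solve-∀

  *-cong : ∀ {i j k l} → i ≋ j → k ≋ l → i * k ≋ j * l
  *-cong {i} {j} {k} {l} (congruent q∣i-j) (congruent q∣k-l) =
    congruent (subst (+ q ∣_) (expand i j k l) (∣m∣n⇒∣m+n (∣m⇒∣m*n k q∣i-j) (∣n⇒∣m*n j q∣k-l)))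
    where
    expand : ∀ i j k l → (i - j) * k + j * (k - l) ≡ i * k - j * l
    expand = solve-∀

  -‿cong : ∀ {i j} → i ≋ j → - i ≋ - j
  -‿cong {i} {j} (congruent q∣i-j) = congruent (subst (+ q ∣_) (neg-difference i j) (∣m⇒∣-m q∣i-j))
    where
    neg-difference : ∀ i j → - (i - j) ≡ - i - - j
    neg-difference = solve-∀

  reduce : ℤ → Fin q
  reduce i = fromℕ< (n%ℕd<d i q)

  toℤ-reduce : ∀ i → toℤ (reduce i) ≋ i
  toℤ-reduce i = ≋-sym (≋-of-multiple (i /ℕ q) (begin
    i                                  ≡⟨ a≡a%ℕn+[a/ℕn]*n i q ⟩
    + (i %ℕ q) + (i /ℕ q) * + q        ≡⟨ cong (λ r → + r + (i /ℕ q) * + q) (toℕ-fromℕ< (n%ℕd<d i q)) ⟨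
    toℤ (reduce i) + (i /ℕ q) * + q    ∎))
    where open ≡-Reasoning

  toℤ-mod : ∀ n → toℤ (n mod q) ≋ + n
  toℤ-mod n = toℤ-reduce (+ n)

  toℤ-+F : ∀ x y → toℤ (x +F y) ≋ toℤ x + toℤ y
  toℤ-+F x y = ≋-trans (toℤ-mod (toℕ x ℕ.+ toℕ y)) (≋-reflexive (ℤ.pos-+ (toℕ x) (toℕ y)))

  toℤ-*F : ∀ x y → toℤ (x *F y) ≋ toℤ x * toℤ y
  toℤ-*F x y = ≋-trans (toℤ-mod (toℕ x ℕ.* toℕ y)) (≋-reflexive (ℤ.pos-* (toℕ x) (toℕ y)))

  toℤ-negF : ∀ x → toℤ (-F x) ≋ - toℤ x
  toℤ-negF x = ≋-trans (toℤ-mod (q ∸ toℕ x)) (≋-of-multiple 1ℤ (begin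
    + (q ∸ toℕ x)           ≡⟨ ℤ.⊖-≥ (ℕ.<⇒≤ (toℕ<n x)) ⟨
    q ⊖ toℕ x               ≡⟨ ℤ.m-n≡m⊖n q (toℕ x) ⟨
    + q - toℤ x             ≡⟨ shift (+ q) (toℤ x) ⟩
    - toℤ x + 1ℤ * + q      ∎))
    where
    open ≡-Reasoning
    shift : ∀ m i → m - i ≡ - i + 1ℤ * m
    shift = solve-∀

  toℤ-subF : ∀ x y → toℤ (x -F y) ≋ toℤ x - toℤ y
  toℤ-subF x y = ≋-trans (toℤ-+F x (-F y)) (+-cong (≋-refl {toℤ x}) (toℤ-negF y))

  toℤ-sumF : ∀ n (f : Fin n → Fin q) → toℤ (sumF n f) ≋ sum (toℤ ∘ f)
  toℤ-sumF zero f = toℤ-mod 0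
  toℤ-sumF (suc n) f =
    ≋-trans (toℤ-+F (f zero) (sumF n (f ∘ suc))) (+-cong (≋-refl {toℤ (f zero)}) (toℤ-sumF n (f ∘ suc)))

  toℤ-injective : ∀ {x y} → toℤ x ≋ toℤ y → x ≡ y
  toℤ-injective {x} {y} (congruent q∣x-y) = toℕ-injective (ℤ.+-injective (ℤ.i-j≡0⇒i≡j _ _ x-y≡0))
    where
    x⊖y≡x-y : toℕ x ⊖ toℕ y ≡ toℤ x - toℤ y
    x⊖y≡x-y = sym (ℤ.m-n≡m⊖n (toℕ x) (toℕ y))

    ∣x⊖y∣<q : ∣ toℕ x ⊖ toℕ y ∣ ℕ.< q
    ∣x⊖y∣<q = ℕ.≤-<-trans (ℤ.∣m⊝n∣≤m⊔n (toℕ x) (toℕ y)) (ℕ.⊔-lub (toℕ<n x) (toℕ<n y))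

    ∣x⊖y∣≡0 : ∣ toℕ x ⊖ toℕ y ∣ ≡ 0
    ∣x⊖y∣≡0 = trans (sym (m<n⇒m%n≡m ∣x⊖y∣<q)) (n∣m⇒m%n≡0 _ q (∣⇒∣ᵤ (subst (+ q ∣_) (sym x⊖y≡x-y) q∣x-y)))

    x-y≡0 : toℤ x - toℤ y ≡ 0ℤ
    x-y≡0 = trans (sym x⊖y≡x-y) (ℤ.∣i∣≡0⇒i≡0 ∣x⊖y∣≡0)

  inverse : Prime q → (x : Fin q) → toℕ x ≢ 0 → ∃ λ e → toℤ x * toℤ e ≋ 1ℤ
  inverse q-prime x x≢0 with coprime-Bézout (prime⇒coprime q-prime {{ℕ.≢-nonZero x≢0}} (toℕ<n x))
  ... | Bézout.+- a b 1+bx≡aq = reduce (- + b) , ≋-trans (*-cong (≋-refl {toℤ x}) (toℤ-reduce (- + b)))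
    (≋-of-multiple (- + a) (begin
      toℤ x * - + b                  ≡⟨ complement (toℤ x) (+ b) ⟩
      1ℤ - (1ℤ + + b * toℤ x)        ≡⟨ cong (λ i → 1ℤ - i) (pos-affine 1 b (toℕ x) a q 1+bx≡aq) ⟩
      1ℤ - + a * + q                 ≡⟨ cong (λ i → 1ℤ + i) (ℤ.neg-distribˡ-* (+ a) (+ q)) ⟩
      1ℤ + - + a * + q               ∎))
    where
    open ≡-Reasoning
    complement : ∀ d b → d * - b ≡ 1ℤ - (1ℤ + b * d)
    complement = solve-∀
  ... | Bézout.-+ a b 1+aq≡bx = reduce (+ b) , ≋-trans (*-cong (≋-refl {toℤ x}) (toℤ-reduce (+ b)))
    (≋-of-multiple (+ a) (begin
      toℤ x * + b                    ≡⟨ ℤ.*-comm (toℤ x) (+ b) ⟩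
      + b * toℤ x                    ≡⟨ pos-affine 1 a q b (toℕ x) 1+aq≡bx ⟨
      1ℤ + + a * + q                 ∎))
    where open ≡-Reasoning

  sum-cong : ∀ {n} {f g : Vector ℤ n} → (∀ j → f j ≋ g j) → sum f ≋ sum g
  sum-cong {zero} _ = ≋-refl
  sum-cong {suc n} f≋g = +-cong (f≋g zero) (sum-cong (f≋g ∘ suc))

sumF-cong : ∀ {q} .{{_ : NonZero q}} n {f g : Fin n → ZMod q} → f ≗ g → sumF n f ≡ sumF n g
sumF-cong zero _ = refl
sumF-cong (suc n) f≗g = cong₂ _+F_ (f≗g zero) (sumF-cong n (f≗g ∘ suc))

module _ {q} .{{_ : NonZero q}} (q-prime : Prime q) (B : Subset {q}) {k} (ξ : Fin (suc k) → ZMod q)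
  (surj : LinSurj B (suc k) ξ)
  (t t' : Fin (suc k) → ZMod q) (t∈B : ∀ j → B (t j)) (t'∈B : ∀ j → B (t' j))
  (m : Fin (suc k)) (tm≢t'm : t m ≢ t' m)
  (Lt≡Lt' : sumF (suc k) (λ j → t j *F ξ j) ≡ sumF (suc k) (λ j → t' j *F ξ j))
  where

  open Modular q
  open import Relation.Binary.Reasoning.Setoid ≋-setoid

  private
    X T T' : Vector ℤ (suc k)
    X = toℤ ∘ ξ
    T = toℤ ∘ t
    T' = toℤ ∘ t'

    toℤ-L : (u : Fin (suc k) → ZMod q) → toℤ (sumF (suc k) (λ j → u j *F ξ j)) ≋ sum (λ j → toℤ (u j) * X j)
    toℤ-L u = ≋-trans (toℤ-sumF (suc k) (λ j → u j *F ξ j)) (sum-cong (λ j → toℤ-*F (u j) (ξ j)))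

    d : ZMod q
    d = t m -F t' m

    D : ℤ
    D = T m - T' m

    d≢0 : toℕ d ≢ 0
    d≢0 d≡0 = tm≢t'm (toℤ-injective (begin
      T m              ≡⟨ split (T m) (T' m) ⟩
      D + T' m         ≈⟨ +-cong (toℤ-subF (t m) (t' m)) (≋-refl {T' m}) ⟨
      toℤ d + T' m     ≡⟨ cong (λ r → + r + T' m) d≡0 ⟩
      0ℤ + T' m        ≡⟨ ℤ.+-identityˡ (T' m) ⟩
      T' m             ∎))
      where
      split : ∀ i j → i ≡ i - j + j
      split = solve-∀

    e : ZMod q
    e = proj₁ (inverse q-prime d d≢0)

    E : ℤ
    E = toℤ e

    DE≋1 : D * E ≋ 1ℤ
    DE≋1 = ≋-trans (*-cong (≋-sym (toℤ-subF (t m) (t' m))) (≋-refl {E})) (proj₂ (inverse q-prime d d≢0))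

    η : Fin k → ZMod q
    η i = ξ (punchIn m i) *F e

    module _ (y : ZMod q) where
      a : Fin (suc k) → ZMod q
      a = proj₁ (surj y)

      A : Vector ℤ (suc k)
      A = toℤ ∘ a

      c : Fin k → ZMod q
      c i = (a (punchIn m i) *F d) +F (a m *F (t' (punchIn m i) -F t (punchIn m i)))

      c∈B̃ : ∀ i → sumset (BmulBminusB B) (BmulBminusB B) (c i)
      c∈B̃ i = _ , _
        , (a (punchIn m i) , t m , t' m , proj₁ (proj₂ (surj y)) (punchIn m i) , t∈B m , t'∈B m , refl)
        , (a m , t' (punchIn m i) , t (punchIn m i) , proj₁ (proj₂ (surj y)) m , t'∈B (punchIn m i) , t∈B (punchIn m i) , refl)
        , refl

      G : Vector ℤ (suc k)
      G j = (A j * D + A m * (T' j - T j)) * X j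

      toℤ-c : ∀ i → toℤ (c i) ≋ A (punchIn m i) * D + A m * (T' (punchIn m i) - T (punchIn m i))
      toℤ-c i = let j = punchIn m i in
        ≋-trans (toℤ-+F (a j *F d) (a m *F (t' j -F t j)))
          (+-cong (≋-trans (toℤ-*F (a j) d) (*-cong (≋-refl {A j}) (toℤ-subF (t m) (t' m))))
                  (≋-trans (toℤ-*F (a m) (t' j -F t j)) (*-cong (≋-refl {A m}) (toℤ-subF (t' j) (t j)))))

      toℤ-cη : ∀ i → toℤ (c i *F η i) ≋ G (punchIn m i) * E
      toℤ-cη i = let j = punchIn m i in begin
        toℤ (c i *F η i)                                 ≈⟨ toℤ-*F (c i) (η i) ⟩
        toℤ (c i) * toℤ (η i)                            ≈⟨ *-cong (toℤ-c i) (toℤ-*F (ξ j) e) ⟩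
        (A j * D + A m * (T' j - T j)) * (X j * E)       ≡⟨ ℤ.*-assoc (A j * D + A m * (T' j - T j)) (X j) E ⟨
        G j * E                                          ∎

      ∑AX≋y : sum (λ j → A j * X j) ≋ toℤ y
      ∑AX≋y = ≋-trans (≋-sym (toℤ-L a)) (≋-reflexive (cong toℤ (proj₂ (proj₂ (surj y)))))

      ∑TX≋∑T'X : sum (λ j → T j * X j) ≋ sum (λ j → T' j * X j)
      ∑TX≋∑T'X = ≋-trans (≋-sym (toℤ-L t)) (≋-trans (≋-reflexive (cong toℤ Lt≡Lt')) (toℤ-L t'))

      c·η≡y : sumF k (λ i → c i *F η i) ≡ y
      c·η≡y = toℤ-injective (begin
        toℤ (sumF k (λ i → c i *F η i))                        ≈⟨ toℤ-sumF k _ ⟩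
        sum (λ i → toℤ (c i *F η i))                           ≈⟨ sum-cong toℤ-cη ⟩
        sum (λ i → G (punchIn m i) * E)                        ≡⟨ *-distribʳ-sum E (removeAt G m) ⟨
        sum (removeAt G m) * E                                 ≡⟨ cong (_* E) (∑-eliminate m A T T' X) ⟩
        (D * ∑AX + A m * (∑T'X - ∑TX)) * E                     ≈⟨ *-cong (+-cong (*-cong (≋-refl {D}) ∑AX≋y)
                                                                    (*-cong (≋-refl {A m}) (+-cong (≋-refl {∑T'X}) (-‿cong ∑TX≋∑T'X))))
                                                                  (≋-refl {E}) ⟩
        (D * toℤ y + A m * (∑T'X - ∑T'X)) * E                  ≡⟨ collapse D (toℤ y) (A m) ∑T'X E ⟩
        (D * E) * toℤ y                                        ≈⟨ *-cong DE≋1 (≋-refl {toℤ y}) ⟩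
        1ℤ * toℤ y                                             ≡⟨ ℤ.*-identityˡ (toℤ y) ⟩
        toℤ y                                                  ∎)
        where
        ∑AX ∑TX ∑T'X : ℤ
        ∑AX = sum (λ j → A j * X j)
        ∑TX = sum (λ j → T j * X j)
        ∑T'X = sum (λ j → T' j * X j)

        collapse : ∀ d y a s e → (d * y + a * (s - s)) * e ≡ (d * e) * y
        collapse = solve-∀

  linSurj-eliminate-coordinate : Σ (Fin k → ZMod q) (LinSurj (sumset (BmulBminusB B) (BmulBminusB B)) k)
  linSurj-eliminate-coordinate = η , λ y → c y , c∈B̃ y , c·η≡y y

lemma4p2 : (q : ℕ) .{{_ : NonZero q}} → Prime q →
    (B : Subset {q}) → Σ (ZMod q) B →
    (k : ℕ) → k > 1 →
    Σ (Fin k → ZMod q) (λ ξ → LinSurj B k ξ) →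
    Σ (Fin (k ∸ 1) → ZMod q) (λ η →
      LinSurj (sumset (BmulBminusB B) (BmulBminusB B)) (k ∸ 1) η)
lemma4p2 q q-prime B _ (suc (suc k)) _ (ξ , surj) =
  let t , t' , t∈B , t'∈B , (m , tm≢t'm) , Lt≡Lt' =
        split-surjection-collides-within q-prime B L L-cong
          (proj₁ ∘ surj) (proj₁ ∘ proj₂ ∘ surj) (proj₂ ∘ proj₂ ∘ surj)
  in linSurj-eliminate-coordinate q-prime B ξ surj t t' t∈B t'∈B m tm≢t'm Lt≡Lt'
  where
  L : (Fin (suc (suc k)) → ZMod q) → ZMod q
  L u = sumF (suc (suc k)) (λ j → u j *F ξ j)

  L-cong : ∀ {u v} → u ≗ v → L u ≡ L v
  L-cong u≗v = sumF-cong (suc (suc k)) (λ j → cong (_*F ξ j) (u≗v j))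
lemma4p2 q q-prime B _ (suc zero) (s≤s ()) _
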